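{- Let $b$ be a positive integer, $\alpha\in S_b^{ -1}\mathbb Z$, and $a$ an integer with $ab\equiv1\pmod{d(\alpha)}$. Then $$D_b(\alpha)=\langle a\alpha\rangle-\left\lfloor\langle a\alpha\rangle-\frac{\alpha}{b}\right\rfloor.$$ Furthermore, if $b\ge\mathfrak n_\alpha$, then $D_b(\alpha)=\langle a\alpha\rangle$ if $\alpha\notin\mathbb Z_{\le0}$, and $D_b(\alpha)=0$ otherwise.
   Context: For $\alpha\in\mathbb Q$, write $\alpha=n(\alpha)/d(\alpha)$ in lowest terms with $d(\alpha)>0$. $S_b^{ -1}\mathbb Z$ is the set of rationals $\alpha$ with $\gcd(d(\alpha),b)=1$; for such $\alpha$, $D_b(\alpha)$ is the unique element of $S_b^{ -1}\mathbb Z$ with $bD_b(\alpha)-\alpha\in\{0,\dots,b-1\}$. For $x\in\mathbb R$, $\langle x\rangle$ is the fractional part of $x$ if $x\notin\mathbb Z$ and $1$ if $x\in\mathbb Z$. $\mathfrak n_\alpha:=n(\alpha)$ if $\alpha\ge0$ and $\mathfrak n_\alpha:=|n(\alpha)|+1$ if $\alpha<0$. -}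

module Defs where

open import Data.Nat as ℕ using (ℕ; suc)
open import Data.Nat.GCD using (gcd)
open import Data.Integer as ℤ using (ℤ; +_; ∣_∣)
open import Data.Integer.Divisibility using () renaming (_∣_ to _∣ℤ_)
open import Data.Rational as ℚ using (ℚ; ↥_; ↧ₙ_; floor; _-_; _+_; _*_; _/_; 0ℚ; 1ℚ; _≤_; _<_)
open import Data.Product using (Σ; _×_; ∃)
open import Data.Sum using (_⊎_)
open import Relation.Binary.PropositionalEquality using (_≡_)
open import Relation.Nullary using (¬_)

d : ℚ → ℕ
d α = ↧ₙ α

n : ℚ → ℤ
n α = ↥ α

ι : ℤ → ℚ
ι z = z / 1

InSbInv : ℕ → ℚ → Set
InSbInv b α = gcd (d α) b ≡ 1

IsDb : ℕ → ℚ → ℚ → Set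
IsDb b α β = InSbInv b β × Σ ℕ (λ k → (k ℕ.< b) × (ι (+ b) * β - α ≡ ι (+ k)))

IsInt : ℚ → Set
IsInt x = d x ≡ 1

⟨_⟩ : ℚ → ℚ
⟨ x ⟩ with d x ℕ.≟ 1
... | Relation.Nullary.yes _ = 1ℚ
... | Relation.Nullary.no _ = x - ι (floor x)

𝔫 : ℚ → ℕ
𝔫 α with ↥ α
... | + m = m
... | ℤ.-[1+ m ] = suc (suc m)

{-# OPTIONS --safe #-}
-- Write q = d(α), p = n(α) and ab − 1 = Tq. For every integer c, β = aα − c has
-- qβ = ap − cq ∈ ℤ, so β ∈ S_b⁻¹ℤ, and bβ − α = Tp − bc ∈ ℤ. The D of the formula is
-- of this shape, and bD − α = b(x − ⌊x⌋) with x = ⟨aα⟩ − α/b lies in [0, b).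
-- D_b(α) is unique: for two candidates, γ = β − β′ has bγ ∈ ℤ ∩ (−b, b), and the
-- denominator of γ divides both b and d(β)d(β′), which is prime to b; so γ = 0.
-- When b ≥ 𝔫_α, the bound 0 ≤ bβ − α < b is checked directly for β = ⟨aα⟩
-- (resp. β = 0 when α ∈ ℤ_{≤0}), which therefore equals D.
module Submission where

open import Defs
open import Data.Nat as ℕ using (ℕ; suc; zero)
open import Data.Nat.Coprimality as Coprimality using (Coprime)
open import Data.Nat.GCD using (gcd-zeroˡ)
open import Data.Nat.Divisibility as ℕDiv using (divides) renaming (_∣_ to _∣ℕ_)
open import Data.Integer as ℤ using (ℤ; +_; -[1+_]; +[1+_])
open import Data.Integer.Divisibility using () renaming (_∣_ to _∣ℤ_)
import Data.Integer.Divisibility.Signed as Signed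
import Data.Integer.DivMod as ℤDivMod
open import Data.Rational as ℚ
  using (ℚ; mkℚ; floor; _-_; _*_; _/_; 0ℚ; 1ℚ; _≤_; _<_; _+_; -_; ↥_; ↧ₙ_; toℚᵘ)
open import Data.Rational.Unnormalised as ℚᵘ using (mkℚᵘ; *≡*)
import Data.Nat.Properties as ℕP
import Data.Integer.Properties as ℤP
import Data.Rational.Properties as ℚP
import Data.Rational.Unnormalised.Properties as ℚᵘP
import Data.Integer.Solver
import Data.Rational.Solver
open import Data.Product using (Σ; _×_; _,_; proj₁; proj₂)
open import Data.Sum using (_⊎_; inj₁; inj₂)
open import Function using (_∘_)
open import Relation.Binary.PropositionalEquality
open import Relation.Nullary using (¬_; yes; no; contradiction)
open import Relation.Binary.Definitions using (tri<; tri≈; tri>)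

module ℤSolver = Data.Integer.Solver.+-*-Solver
module ℚSolver = Data.Rational.Solver.+-*-Solver

ι≡mkℚ : ∀ z → ι z ≡ mkℚ z 0 (Coprimality.sym (Coprimality.1-coprimeTo ℤ.∣ z ∣))
ι≡mkℚ z = ℚP.fromℚᵘ-toℚᵘ _

↥-ι : ∀ z → ↥ ι z ≡ z
↥-ι z = cong ↥_ (ι≡mkℚ z)

d-ι : ∀ z → d (ι z) ≡ 1
d-ι z = cong ↧ₙ_ (ι≡mkℚ z)

ι-injective : ∀ {x y} → ι x ≡ ι y → x ≡ y
ι-injective {x} {y} eq = trans (sym (↥-ι x)) (trans (cong ↥_ eq) (↥-ι y))

toℚᵘ-ι : ∀ z → toℚᵘ (ι z) ≡ mkℚᵘ z 0
toℚᵘ-ι z = cong toℚᵘ (ι≡mkℚ z)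

ι-homo-+ : ∀ x y → ι (x ℤ.+ y) ≡ ι x + ι y
ι-homo-+ x y = ℚP.toℚᵘ-injective (begin
  toℚᵘ (ι (x ℤ.+ y))
    ≡⟨ toℚᵘ-ι (x ℤ.+ y) ⟩
  mkℚᵘ (x ℤ.+ y) 0
    ≈⟨ *≡* (solve 2 (λ x y → (x :+ y) :* con (+ 1) := (x :* con (+ 1) :+ y :* con (+ 1)) :* con (+ 1)) refl x y) ⟩
  mkℚᵘ x 0 ℚᵘ.+ mkℚᵘ y 0
    ≡⟨ cong₂ ℚᵘ._+_ (toℚᵘ-ι x) (toℚᵘ-ι y) ⟨
  toℚᵘ (ι x) ℚᵘ.+ toℚᵘ (ι y)
    ≈⟨ ℚP.toℚᵘ-homo-+ (ι x) (ι y) ⟨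
  toℚᵘ (ι x + ι y) ∎)
  where
    open ℚᵘP.≃-Reasoning
    open ℤSolver

ι-homo-* : ∀ x y → ι (x ℤ.* y) ≡ ι x * ι y
ι-homo-* x y = ℚP.toℚᵘ-injective (begin
  toℚᵘ (ι (x ℤ.* y))         ≡⟨ toℚᵘ-ι (x ℤ.* y) ⟩
  mkℚᵘ x 0 ℚᵘ.* mkℚᵘ y 0      ≡⟨ cong₂ ℚᵘ._*_ (toℚᵘ-ι x) (toℚᵘ-ι y) ⟨
  toℚᵘ (ι x) ℚᵘ.* toℚᵘ (ι y)  ≈⟨ ℚP.toℚᵘ-homo-* (ι x) (ι y) ⟨
  toℚᵘ (ι x * ι y)            ∎)
  where
    open ℚᵘP.≃-Reasoning

ι-homo‿- : ∀ x → ι (ℤ.- x) ≡ - ι x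
ι-homo‿- x = ℚP.toℚᵘ-injective (begin
  toℚᵘ (ι (ℤ.- x))  ≡⟨ toℚᵘ-ι (ℤ.- x) ⟩
  ℚᵘ.- mkℚᵘ x 0      ≡⟨ cong ℚᵘ.-_ (toℚᵘ-ι x) ⟨
  ℚᵘ.- toℚᵘ (ι x)    ≈⟨ ℚP.toℚᵘ-homo‿- (ι x) ⟨
  toℚᵘ (- ι x)       ∎)
  where
    open ℚᵘP.≃-Reasoning

ι-homo-- : ∀ x y → ι (x ℤ.- y) ≡ ι x - ι y
ι-homo-- x y = trans (ι-homo-+ x (ℤ.- y)) (cong (λ z → ι x + z) (ι-homo‿- y))

ι-mono-≤ : ∀ {x y} → x ℤ.≤ y → ι x ≤ ι y
ι-mono-≤ {x} {y} x≤y rewrite ι≡mkℚ x | ι≡mkℚ y = ℚ.*≤* (ℤP.*-monoʳ-≤-nonNeg (+ 1) x≤y)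

ι-cancel-≤ : ∀ {x y} → ι x ≤ ι y → x ℤ.≤ y
ι-cancel-≤ {x} {y} ιx≤ιy rewrite ι≡mkℚ x | ι≡mkℚ y with ιx≤ιy
... | ℚ.*≤* x*1≤y*1 = subst₂ ℤ._≤_ (ℤP.*-identityʳ x) (ℤP.*-identityʳ y) x*1≤y*1

ι-mono-< : ∀ {x y} → x ℤ.< y → ι x < ι y
ι-mono-< {x} {y} x<y rewrite ι≡mkℚ x | ι≡mkℚ y =
  ℚ.*<* (subst₂ ℤ._<_ (sym (ℤP.*-identityʳ x)) (sym (ℤP.*-identityʳ y)) x<y)

ι-cancel-< : ∀ {x y} → ι x < ι y → x ℤ.< y
ι-cancel-< {x} {y} ιx<ιy rewrite ι≡mkℚ x | ι≡mkℚ y with ιx<ιy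
... | ℚ.*<* x*1<y*1 = subst₂ ℤ._<_ (ℤP.*-identityʳ x) (ℤP.*-identityʳ y) x*1<y*1

IsInt⇒≡ι↥ : ∀ x → IsInt x → x ≡ ι (↥ x)
IsInt⇒≡ι↥ (mkℚ n zero _) refl = sym (ι≡mkℚ n)

module _ (n : ℕ) where

  ι-scale-mono-≤ : ∀ {x y i j} → x * ι (+ n) ≡ ι i → y * ι (+ n) ≡ ι j → x ≤ y → i ℤ.≤ j
  ι-scale-mono-≤ xn≡i yn≡j x≤y = ι-cancel-≤ (subst₂ _≤_ xn≡i yn≡j (ℚP.*-monoʳ-≤-nonNeg (ι (+ n)) x≤y))
    where
    instance
      ιn-nonNeg : ℚ.NonNegative (ι (+ n))
      ιn-nonNeg = ℚ.nonNegative (ι-mono-≤ {+ 0} {+ n} (ℤ.+≤+ ℕ.z≤n))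

  ι-scale-mono-< : .{{ℕ.NonZero n}} → ∀ {x y i j} →
                   x * ι (+ n) ≡ ι i → y * ι (+ n) ≡ ι j → x < y → i ℤ.< j
  ι-scale-mono-< xn≡i yn≡j x<y = ι-cancel-< (subst₂ _<_ xn≡i yn≡j (ℚP.*-monoˡ-<-pos (ι (+ n)) x<y))
    where
    instance
      ιn-pos : ℚ.Positive (ι (+ n))
      ιn-pos = ℚ.positive (ι-mono-< {+ 0} {+ n} (ℤ.+<+ (ℕP.n≢0⇒n>0 (ℕ.≢-nonZero⁻¹ n))))

  0*ι≡ι0 : 0ℚ * ι (+ n) ≡ ι (+ 0)
  0*ι≡ι0 = ℚP.*-zeroˡ (ι (+ n))

  1*ι≡ι : 1ℚ * ι (+ n) ≡ ι (+ n)
  1*ι≡ι = ℚP.*-identityˡ (ι (+ n))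

≤∧≢⇒< : ∀ {x y : ℚ} → x ≤ y → x ≢ y → x < y
≤∧≢⇒< {x} {y} x≤y x≢y with ℚP.<-cmp x y
... | tri< x<y _ _ = x<y
... | tri≈ _ x≡y _ = contradiction x≡y x≢y
... | tri> _ _ y<x = contradiction (ℚP.<-≤-trans y<x x≤y) (ℚP.<-irrefl refl)

x-y≡0⇒x≡y : ∀ {x y} → x - y ≡ 0ℚ → x ≡ y
x-y≡0⇒x≡y {x} {y} x-y≡0 = begin
  x             ≡⟨ solve 2 (λ x y → x := (x :- y) :+ y) refl x y ⟩
  (x - y) + y   ≡⟨ cong (_+ y) x-y≡0 ⟩
  0ℚ + y        ≡⟨ ℚP.+-identityˡ y ⟩
  y             ∎
  where
    open ≡-Reasoning
    open ℚSolver

ι-floor-≤ : ∀ x → ι (floor x) ≤ x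
ι-floor-≤ x@(mkℚ n d-1 _) rewrite ι≡mkℚ (floor x) =
  ℚ.*≤* (subst (floor x ℤ.* + suc d-1 ℤ.≤_) (sym (ℤP.*-identityʳ n)) (ℤDivMod.[n/d]*d≤n n (+ suc d-1)))

<ι-floor+1 : ∀ x → x < ι (floor x ℤ.+ + 1)
<ι-floor+1 x@(mkℚ n d-1 _) rewrite ι≡mkℚ (floor x ℤ.+ + 1) =
  ℚ.*<* (subst₂ ℤ._<_ (sym (ℤP.*-identityʳ n)) suc[n/d]*d≡[⌊x⌋+1]*d (ℤDivMod.n<s[n/ℕd]*d n (suc d-1)))
  where
  suc[n/d]*d≡[⌊x⌋+1]*d : ℤ.suc (n ℤ./ℕ suc d-1) ℤ.* + suc d-1 ≡ (floor x ℤ.+ + 1) ℤ.* + suc d-1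
  suc[n/d]*d≡[⌊x⌋+1]*d = trans (cong (λ m → ℤ.suc m ℤ.* + suc d-1) (sym (ℤDivMod.div-pos-is-/ℕ n (suc d-1))))
                               (cong (ℤ._* + suc d-1) (ℤP.+-comm (+ 1) (floor x)))

0≤x-ι⌊x⌋ : ∀ x → 0ℚ ≤ x - ι (floor x)
0≤x-ι⌊x⌋ x = subst (_≤ x - ι (floor x)) (ℚP.+-inverseʳ (ι (floor x)))
                   (ℚP.+-monoˡ-≤ (- ι (floor x)) (ι-floor-≤ x))

x-ι⌊x⌋<1 : ∀ x → x - ι (floor x) < 1ℚ
x-ι⌊x⌋<1 x = subst (x - ι (floor x) <_) [⌊x⌋+1]-⌊x⌋≡1 (ℚP.+-monoˡ-< (- ι (floor x)) (<ι-floor+1 x))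
  where
  [⌊x⌋+1]-⌊x⌋≡1 : ι (floor x ℤ.+ + 1) - ι (floor x) ≡ 1ℚ
  [⌊x⌋+1]-⌊x⌋≡1 = trans (cong (_- ι (floor x)) (ι-homo-+ (floor x) (+ 1)))
                        (solve 1 (λ f → (f :+ con 1ℚ) :- f := con 1ℚ) refl (ι (floor x)))
    where
      open ℚSolver

⟨⟩-shift : ∀ x → Σ ℤ λ c → ⟨ x ⟩ ≡ x - ι c
⟨⟩-shift x with d x ℕ.≟ 1
... | yes x∈ℤ = ↥ x ℤ.- + 1 , (begin
  1ℚ                          ≡⟨ solve 1 (λ u → con 1ℚ := u :- (u :- con 1ℚ)) refl (ι (↥ x)) ⟩
  ι (↥ x) - (ι (↥ x) - 1ℚ)    ≡⟨ cong₂ _-_ (IsInt⇒≡ι↥ x x∈ℤ) (ι-homo-- (↥ x) (+ 1)) ⟨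
  x - ι (↥ x ℤ.- + 1)         ∎)
  where
    open ≡-Reasoning
    open ℚSolver
... | no _ = floor x , refl

0<⟨⟩ : ∀ x → 0ℚ < ⟨ x ⟩
0<⟨⟩ x with d x ℕ.≟ 1
... | yes _ = ℚP.positive⁻¹ 1ℚ
... | no x∉ℤ = ≤∧≢⇒< (0≤x-ι⌊x⌋ x) (x∉ℤ ∘ x-ι⌊x⌋≡0⇒IsInt ∘ sym)
  where
  x-ι⌊x⌋≡0⇒IsInt : x - ι (floor x) ≡ 0ℚ → IsInt x
  x-ι⌊x⌋≡0⇒IsInt eq = subst IsInt (sym (x-y≡0⇒x≡y {x} {ι (floor x)} eq)) (d-ι (floor x))

⟨⟩<1 : ∀ x → ¬ IsInt x → ⟨ x ⟩ < 1ℚ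
⟨⟩<1 x x∉ℤ with d x ℕ.≟ 1
... | yes x∈ℤ = contradiction x∈ℤ x∉ℤ
... | no _ = x-ι⌊x⌋<1 x

⟨⟩≤1 : ∀ x → ⟨ x ⟩ ≤ 1ℚ
⟨⟩≤1 x with d x ℕ.≟ 1
... | yes _ = ℚP.≤-refl
... | no _ = ℚP.<⇒≤ (x-ι⌊x⌋<1 x)

*-d≡↥ : ∀ x → x * ι (+ d x) ≡ ι (↥ x)
*-d≡↥ x@(mkℚ n d-1 _) = ℚP.toℚᵘ-injective (begin
  toℚᵘ (x * ι (+ suc d-1))
    ≈⟨ ℚP.toℚᵘ-homo-* x (ι (+ suc d-1)) ⟩
  toℚᵘ x ℚᵘ.* toℚᵘ (ι (+ suc d-1))
    ≡⟨ cong (toℚᵘ x ℚᵘ.*_) (toℚᵘ-ι (+ suc d-1)) ⟩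
  mkℚᵘ n d-1 ℚᵘ.* mkℚᵘ (+ suc d-1) 0
    ≈⟨ *≡* (solve 2 (λ n e → (n :* e) :* con (+ 1) := n :* (e :* con (+ 1))) refl n (+ suc d-1)) ⟩
  mkℚᵘ n 0
    ≡⟨ toℚᵘ-ι n ⟨
  toℚᵘ (ι n) ∎)
  where
    open ℚᵘP.≃-Reasoning
    open ℤSolver

integral-multiple⇒d∣ : ∀ x q z → x * ι (+ q) ≡ ι z → d x ∣ℕ q
integral-multiple⇒d∣ x@(mkℚ n d-1 n⊥d) q z xq≡z =
  Coprimality.coprime-divisor (Coprimality.sym (Coprimality.recompute n⊥d)) (divides ℤ.∣ z ∣ ∣n∣q≡∣z∣d)
  where
  n*q*1≡z*d : n ℤ.* + q ℤ.* + 1 ≡ z ℤ.* + suc (d-1 ℕ.* 1)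
  n*q*1≡z*d = ℚᵘP.drop-*≡* (begin
    mkℚᵘ n d-1 ℚᵘ.* mkℚᵘ (+ q) 0    ≡⟨ cong (toℚᵘ x ℚᵘ.*_) (toℚᵘ-ι (+ q)) ⟨
    toℚᵘ x ℚᵘ.* toℚᵘ (ι (+ q))      ≈⟨ ℚP.toℚᵘ-homo-* x (ι (+ q)) ⟨
    toℚᵘ (x * ι (+ q))              ≡⟨ cong toℚᵘ xq≡z ⟩
    toℚᵘ (ι z)                      ≡⟨ toℚᵘ-ι z ⟩
    mkℚᵘ z 0                        ∎)
    where
      open ℚᵘP.≃-Reasoning
  n*q≡z*d : n ℤ.* + q ≡ z ℤ.* + suc d-1
  n*q≡z*d = trans (sym (ℤP.*-identityʳ (n ℤ.* + q)))
                  (trans n*q*1≡z*d (cong (λ e → z ℤ.* + suc e) (ℕP.*-identityʳ d-1)))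
  ∣n∣q≡∣z∣d : ℤ.∣ n ∣ ℕ.* q ≡ ℤ.∣ z ∣ ℕ.* suc d-1
  ∣n∣q≡∣z∣d = trans (sym (ℤP.∣i*j∣≡∣i∣*∣j∣ n (+ q)))
                    (trans (cong ℤ.∣_∣ n*q≡z*d) (ℤP.∣i*j∣≡∣i∣*∣j∣ z (+ suc d-1)))

coprime-integral-multiples⇒IsInt : ∀ x {m n} i j → Coprime m n →
  x * ι (+ m) ≡ ι i → x * ι (+ n) ≡ ι j → IsInt x
coprime-integral-multiples⇒IsInt x {m} {n} i j m⊥n xm≡i xn≡j =
  m⊥n (integral-multiple⇒d∣ x m i xm≡i , integral-multiple⇒d∣ x n j xn≡j)

integral-multiple⇒InSbInv : ∀ {b q} x z → Coprime q b → x * ι (+ q) ≡ ι z → InSbInv b x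
integral-multiple⇒InSbInv {q = q} x z q⊥b xq≡z = Coprimality.coprime⇒gcd≡1 λ (k∣d , k∣b) →
  q⊥b (ℕDiv.∣-trans k∣d (integral-multiple⇒d∣ x q z xq≡z) , k∣b)

coprime-*ˡ : ∀ {m n o} → Coprime m o → Coprime n o → Coprime (m ℕ.* n) o
coprime-*ˡ m⊥o n⊥o (k∣mn , k∣o) =
  n⊥o (Coprimality.coprime-divisor (λ (j∣k , j∣m) → m⊥o (j∣m , ℕDiv.∣-trans j∣k k∣o)) k∣mn , k∣o)

-- D_b(α): introduction and uniqueness

IsDb-intro : ∀ {b α β} K → InSbInv b β → ι (+ b) * β - α ≡ ι K →
             + 0 ℤ.≤ K → K ℤ.< + b → IsDb b α β
IsDb-intro (+ k) β∈S eq _ k<b = β∈S , k , ℤP.drop‿+<+ k<b , eq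

k-k′≢b*[1+n] : ∀ {b k k′} n → k ℕ.< b → + k ℤ.- + k′ ≢ + b ℤ.* +[1+ n ]
k-k′≢b*[1+n] {b} {k} {k′} n k<b eq = ℕP.<-irrefl refl (ℕP.<-≤-trans k<b (ℕP.≤-trans b≤b[1+n] b[1+n]≤k))
  where
  b≤b[1+n] : b ℕ.≤ b ℕ.* suc n
  b≤b[1+n] = ℕP.m≤m*n b (suc n)
  b[1+n]≤k : b ℕ.* suc n ℕ.≤ k
  b[1+n]≤k = ℤP.drop‿+≤+ (subst (ℤ._≤ + k) (trans eq (sym (ℤP.pos-* b (suc n))))
                                (ℤP.i≤j⇒i-k≤j (+ k′) ℤP.≤-refl))

k-k′≡b*g⇒g≡0 : ∀ {b k k′} g → k ℕ.< b → k′ ℕ.< b → + k ℤ.- + k′ ≡ + b ℤ.* g → g ≡ + 0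
k-k′≡b*g⇒g≡0 (+ zero)   _   _    _  = refl
k-k′≡b*g⇒g≡0 {k′ = k′} +[1+ n ] k<b _ eq = contradiction eq (k-k′≢b*[1+n] {k′ = k′} n k<b)
k-k′≡b*g⇒g≡0 {b} {k} {k′} -[1+ n ] _ k′<b eq = contradiction k′-k≡b*[1+n] (k-k′≢b*[1+n] {k′ = k} n k′<b)
  where
  k′-k≡b*[1+n] : + k′ ℤ.- + k ≡ + b ℤ.* +[1+ n ]
  k′-k≡b*[1+n] = begin
    + k′ ℤ.- + k             ≡⟨ solve 2 (λ k k′ → k′ :- k := :- (k :- k′)) refl (+ k) (+ k′) ⟩
    ℤ.- (+ k ℤ.- + k′)       ≡⟨ cong ℤ.-_ eq ⟩
    ℤ.- (+ b ℤ.* -[1+ n ])   ≡⟨ ℤP.neg-distribʳ-* (+ b) -[1+ n ] ⟩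
    + b ℤ.* +[1+ n ]         ∎
    where
      open ≡-Reasoning
      open ℤSolver

IsDb-unique : ∀ {b α β β′} → IsDb b α β → IsDb b α β′ → β ≡ β′
IsDb-unique {b} {α} {β} {β′} (β∈S , k , k<b , bβ-α≡k) (β′∈S , k′ , k′<b , bβ′-α≡k′) =
  x-y≡0⇒x≡y (trans (IsInt⇒≡ι↥ γ γ∈ℤ) (cong ι ↥γ≡0))
  where
  open ≡-Reasoning
  γ : ℚ
  γ = β - β′
  γb≡k-k′ : γ * ι (+ b) ≡ ι (+ k ℤ.- + k′)
  γb≡k-k′ = begin
    (β - β′) * ι (+ b)
      ≡⟨ solve 4 (λ β β′ B α → (β :- β′) :* B := (B :* β :- α) :- (B :* β′ :- α)) refl β β′ (ι (+ b)) α ⟩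
    (ι (+ b) * β - α) - (ι (+ b) * β′ - α)
      ≡⟨ cong₂ _-_ bβ-α≡k bβ′-α≡k′ ⟩
    ι (+ k) - ι (+ k′)
      ≡⟨ ι-homo-- (+ k) (+ k′) ⟨
    ι (+ k ℤ.- + k′) ∎
    where
      open ℚSolver
  Q Q′ : ℕ
  Q = d β
  Q′ = d β′
  γQQ′≡integer : γ * ι (+ (Q ℕ.* Q′)) ≡ ι (↥ β ℤ.* + Q′ ℤ.- ↥ β′ ℤ.* + Q)
  γQQ′≡integer = begin
    (β - β′) * ι (+ (Q ℕ.* Q′))
      ≡⟨ cong (λ z → (β - β′) * ι z) (ℤP.pos-* Q Q′) ⟩
    (β - β′) * ι (+ Q ℤ.* + Q′)
      ≡⟨ cong ((β - β′) *_) (ι-homo-* (+ Q) (+ Q′)) ⟩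
    (β - β′) * (ι (+ Q) * ι (+ Q′))
      ≡⟨ solve 4 (λ β β′ Q Q′ → (β :- β′) :* (Q :* Q′) := (β :* Q) :* Q′ :- (β′ :* Q′) :* Q) refl β β′ (ι (+ Q)) (ι (+ Q′)) ⟩
    (β * ι (+ Q)) * ι (+ Q′) - (β′ * ι (+ Q′)) * ι (+ Q)
      ≡⟨ cong₂ (λ u v → u * ι (+ Q′) - v * ι (+ Q)) (*-d≡↥ β) (*-d≡↥ β′) ⟩
    ι (↥ β) * ι (+ Q′) - ι (↥ β′) * ι (+ Q)
      ≡⟨ cong₂ _-_ (ι-homo-* (↥ β) (+ Q′)) (ι-homo-* (↥ β′) (+ Q)) ⟨
    ι (↥ β ℤ.* + Q′) - ι (↥ β′ ℤ.* + Q)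
      ≡⟨ ι-homo-- (↥ β ℤ.* + Q′) (↥ β′ ℤ.* + Q) ⟨
    ι (↥ β ℤ.* + Q′ ℤ.- ↥ β′ ℤ.* + Q) ∎
    where
      open ℚSolver
  QQ′⊥b : Coprime (Q ℕ.* Q′) b
  QQ′⊥b = coprime-*ˡ (Coprimality.gcd≡1⇒coprime β∈S) (Coprimality.gcd≡1⇒coprime β′∈S)
  γ∈ℤ : IsInt γ
  γ∈ℤ = coprime-integral-multiples⇒IsInt γ (↥ β ℤ.* + Q′ ℤ.- ↥ β′ ℤ.* + Q) (+ k ℤ.- + k′)
                                           QQ′⊥b γQQ′≡integer γb≡k-k′
  ↥γ≡0 : ↥ γ ≡ + 0
  ↥γ≡0 = k-k′≡b*g⇒g≡0 (↥ γ) k<b k′<b (ι-injective (begin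
    ι (+ k ℤ.- + k′)        ≡⟨ γb≡k-k′ ⟨
    γ * ι (+ b)             ≡⟨ cong (_* ι (+ b)) (IsInt⇒≡ι↥ γ γ∈ℤ) ⟩
    ι (↥ γ) * ι (+ b)       ≡⟨ ℚP.*-comm (ι (↥ γ)) (ι (+ b)) ⟩
    ι (+ b) * ι (↥ γ)       ≡⟨ ι-homo-* (+ b) (↥ γ) ⟨
    ι (+ b ℤ.* ↥ γ)         ∎))

q*K≡b*z-p⇒0≤K<b : ∀ {b q : ℕ} {z p K : ℤ} → + q ℤ.* K ≡ + b ℤ.* z ℤ.- p →
  + 1 ℤ.≤ z → z ℤ.≤ + q → p ℤ.≤ + b → ℤ.- p ℤ.< + b → (+ 0 ℤ.< p ⊎ z ℤ.< + q) →
  + 0 ℤ.≤ K × K ℤ.< + b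
q*K≡b*z-p⇒0≤K<b {b} {q} {z} {p} {K} qK≡bz-p 1≤z z≤q p≤b -p<b 0<p⊎z<q =
  ℤP.*-cancelˡ-≤-pos (+ 0) K (+ q) (subst₂ ℤ._≤_ (sym (ℤP.*-zeroʳ (+ q))) (sym qK≡bz-p) 0≤bz-p) ,
  ℤP.*-cancelˡ-<-nonNeg (+ q) (subst₂ ℤ._<_ (sym qK≡bz-p) (ℤP.*-comm (+ b) (+ q)) (bz-p<bq 0<p⊎z<q))
  where
  instance
    q-pos : ℤ.Positive (+ q)
    q-pos = ℤ.positive (ℤP.<-≤-trans (ℤ.+<+ (ℕ.s≤s ℕ.z≤n)) (ℤP.≤-trans 1≤z z≤q))
  b≤bz : + b ℤ.≤ + b ℤ.* z
  b≤bz = subst (ℤ._≤ + b ℤ.* z) (ℤP.*-identityʳ (+ b)) (ℤP.*-monoˡ-≤-nonNeg (+ b) 1≤z)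
  0≤bz-p : + 0 ℤ.≤ + b ℤ.* z ℤ.- p
  0≤bz-p = ℤP.i≤j⇒0≤j-i (ℤP.≤-trans p≤b b≤bz)
  bz≤bq : + b ℤ.* z ℤ.≤ + b ℤ.* + q
  bz≤bq = ℤP.*-monoˡ-≤-nonNeg (+ b) z≤q
  bz-p<bq : + 0 ℤ.< p ⊎ z ℤ.< + q → + b ℤ.* z ℤ.- p ℤ.< + b ℤ.* + q
  bz-p<bq (inj₁ 0<p) = ℤP.<-≤-trans (subst (+ b ℤ.* z ℤ.- p ℤ.<_) (ℤP.+-identityʳ (+ b ℤ.* z))
                                        (ℤP.+-monoʳ-< (+ b ℤ.* z) (ℤP.neg-mono-< 0<p)))
                                 bz≤bq
  bz-p<bq (inj₂ z<q) = ℤP.<-≤-trans (subst (+ b ℤ.* z ℤ.- p ℤ.<_) bz+b≡b[1+z] (ℤP.+-monoʳ-< (+ b ℤ.* z) -p<b))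
                                 (ℤP.*-monoˡ-≤-nonNeg (+ b) (ℤP.i<j⇒suc[i]≤j z<q))
    where
    bz+b≡b[1+z] : + b ℤ.* z ℤ.+ + b ≡ + b ℤ.* ℤ.suc z
    bz+b≡b[1+z] = solve 2 (λ b z → b :* z :+ b := b :* (con (+ 1) :+ z)) refl (+ b) z
      where
        open ℤSolver

𝔫≤b⇒bounds : ∀ α {b} .{{_ : ℕ.NonZero b}} → 𝔫 α ℕ.≤ b → ↥ α ℤ.≤ + b × ℤ.- ↥ α ℤ.< + b
𝔫≤b⇒bounds (mkℚ (+ n) _ _) {b} n≤b =
  ℤ.+≤+ n≤b , ℤP.≤-<-trans (ℤP.neg-mono-≤ (ℤ.+≤+ ℕ.z≤n)) (ℤ.+<+ (ℕP.n≢0⇒n>0 (ℕ.≢-nonZero⁻¹ b)))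
𝔫≤b⇒bounds (mkℚ -[1+ n ] _ _) 2+n≤b = ℤ.-≤+ , ℤ.+<+ 2+n≤b

IsDb-0 : ∀ {b α} .{{_ : ℕ.NonZero b}} → 𝔫 α ℕ.≤ b → IsInt α → α ≤ 0ℚ → IsDb b α 0ℚ
IsDb-0 {b} {α} 𝔫≤b α∈ℤ α≤0 =
  IsDb-intro (ℤ.- ↥ α) (gcd-zeroˡ b) b*0-α≡-p (ℤP.neg-mono-≤ p≤0) (proj₂ (𝔫≤b⇒bounds α 𝔫≤b))
  where
  α≡ιp : α ≡ ι (↥ α)
  α≡ιp = IsInt⇒≡ι↥ α α∈ℤ
  p≤0 : ↥ α ℤ.≤ + 0
  p≤0 = ι-cancel-≤ (subst (_≤ 0ℚ) α≡ιp α≤0)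
  b*0-α≡-p : ι (+ b) * 0ℚ - α ≡ ι (ℤ.- ↥ α)
  b*0-α≡-p = begin
    ι (+ b) * 0ℚ - α   ≡⟨ cong (_- α) (ℚP.*-zeroʳ (ι (+ b))) ⟩
    0ℚ - α             ≡⟨ ℚP.+-identityˡ (- α) ⟩
    - α                ≡⟨ cong -_ α≡ιp ⟩
    - ι (↥ α)          ≡⟨ ι-homo‿- (↥ α) ⟨
    ι (ℤ.- ↥ α)        ∎
    where
      open ≡-Reasoning

1/n*n≡1 : ∀ n .{{_ : ℕ.NonZero n}} → (+ 1 / n) * ι (+ n) ≡ 1ℚ
1/n*n≡1 (suc n-1) = ℚP.toℚᵘ-injective (begin
  toℚᵘ ((+ 1 / suc n-1) * ι (+ suc n-1))
    ≈⟨ ℚP.toℚᵘ-homo-* (+ 1 / suc n-1) (ι (+ suc n-1)) ⟩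
  toℚᵘ (+ 1 / suc n-1) ℚᵘ.* toℚᵘ (ι (+ suc n-1))
    ≈⟨ ℚᵘP.*-cong (ℚP.toℚᵘ-fromℚᵘ (mkℚᵘ (+ 1) n-1)) (ℚᵘP.≃-reflexive (toℚᵘ-ι (+ suc n-1))) ⟩
  mkℚᵘ (+ 1) n-1 ℚᵘ.* mkℚᵘ (+ suc n-1) 0
    ≈⟨ *≡* (cong (+_ ∘ suc) (trans (ℕP.*-identityʳ (n-1 ℕ.+ 0)) (cong (ℕ._+ 0) (sym (ℕP.*-identityʳ n-1))))) ⟩
  ℚᵘ.1ℚᵘ ∎)
  where
    open ℚᵘP.≃-Reasoning

*1/n*n≡id : ∀ x n .{{_ : ℕ.NonZero n}} → x * (+ 1 / n) * ι (+ n) ≡ x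
*1/n*n≡id x n = begin
  x * (+ 1 / n) * ι (+ n)      ≡⟨ ℚP.*-assoc x (+ 1 / n) (ι (+ n)) ⟩
  x * ((+ 1 / n) * ι (+ n))    ≡⟨ cong (x *_) (1/n*n≡1 n) ⟩
  x * 1ℚ                       ≡⟨ ℚP.*-identityʳ x ⟩
  x                            ∎
  where
    open ≡-Reasoning

-- The candidates aα − c for an inverse a of b modulo d(α)

module ModularInverse (b : ℕ) .{{_ : ℕ.NonZero b}} (α : ℚ) (q⊥b : Coprime (d α) b)
                      (a T : ℤ) (ab-1≡Tq : a ℤ.* + b ℤ.- + 1 ≡ T ℤ.* + d α) where

  private
    q : ℕ
    q = d α
    p : ℤ
    p = ↥ α

  shifted : ℤ → ℚ
  shifted c = ι a * α - ι c

  ιa*ιb≡1+ιT*ιq : ι a * ι (+ b) ≡ 1ℚ + ι T * ι (+ q)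
  ιa*ιb≡1+ιT*ιq = begin
    ι a * ι (+ b)               ≡⟨ ι-homo-* a (+ b) ⟨
    ι (a ℤ.* + b)               ≡⟨ cong ι ab≡1+Tq ⟩
    ι (+ 1 ℤ.+ T ℤ.* + q)       ≡⟨ ι-homo-+ (+ 1) (T ℤ.* + q) ⟩
    1ℚ + ι (T ℤ.* + q)          ≡⟨ cong (λ u → 1ℚ + u) (ι-homo-* T (+ q)) ⟩
    1ℚ + ι T * ι (+ q)          ∎
    where
    open ≡-Reasoning
    ab≡1+Tq : a ℤ.* + b ≡ + 1 ℤ.+ T ℤ.* + q
    ab≡1+Tq = trans (solve 1 (λ x → x := con (+ 1) :+ (x :- con (+ 1))) refl (a ℤ.* + b))
                    (cong (λ u → + 1 ℤ.+ u) ab-1≡Tq)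
      where
        open ℤSolver

  shifted-*-q : ∀ c → shifted c * ι (+ q) ≡ ι (a ℤ.* p ℤ.- c ℤ.* + q)
  shifted-*-q c = begin
    (ι a * α - ι c) * ι (+ q)
      ≡⟨ solve 4 (λ A α C Q → (A :* α :- C) :* Q := A :* (α :* Q) :- C :* Q) refl (ι a) α (ι c) (ι (+ q)) ⟩
    ι a * (α * ι (+ q)) - ι c * ι (+ q)
      ≡⟨ cong (λ u → ι a * u - ι c * ι (+ q)) (*-d≡↥ α) ⟩
    ι a * ι p - ι c * ι (+ q)
      ≡⟨ cong₂ _-_ (ι-homo-* a p) (ι-homo-* c (+ q)) ⟨
    ι (a ℤ.* p) - ι (c ℤ.* + q)
      ≡⟨ ι-homo-- (a ℤ.* p) (c ℤ.* + q) ⟨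
    ι (a ℤ.* p ℤ.- c ℤ.* + q) ∎
    where
      open ≡-Reasoning
      open ℚSolver

  b*shifted-α : ∀ c → ι (+ b) * shifted c - α ≡ ι (T ℤ.* p ℤ.- + b ℤ.* c)
  b*shifted-α c = begin
    ι (+ b) * (ι a * α - ι c) - α
      ≡⟨ solve 4 (λ B A α C → B :* (A :* α :- C) :- α := (A :* B) :* α :- α :- B :* C) refl (ι (+ b)) (ι a) α (ι c) ⟩
    (ι a * ι (+ b)) * α - α - ι (+ b) * ι c
      ≡⟨ cong (λ u → u * α - α - ι (+ b) * ι c) ιa*ιb≡1+ιT*ιq ⟩
    (1ℚ + ι T * ι (+ q)) * α - α - ι (+ b) * ι c
      ≡⟨ solve 5 (λ T Q α B C → (con 1ℚ :+ T :* Q) :* α :- α :- B :* C := T :* (α :* Q) :- B :* C) refl (ι T) (ι (+ q)) α (ι (+ b)) (ι c) ⟩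
    ι T * (α * ι (+ q)) - ι (+ b) * ι c
      ≡⟨ cong (λ u → ι T * u - ι (+ b) * ι c) (*-d≡↥ α) ⟩
    ι T * ι p - ι (+ b) * ι c
      ≡⟨ cong₂ _-_ (ι-homo-* T p) (ι-homo-* (+ b) c) ⟨
    ι (T ℤ.* p) - ι (+ b ℤ.* c)
      ≡⟨ ι-homo-- (T ℤ.* p) (+ b ℤ.* c) ⟨
    ι (T ℤ.* p ℤ.- + b ℤ.* c) ∎
    where
      open ≡-Reasoning
      open ℚSolver

  shifted∈S : ∀ c → InSbInv b (shifted c)
  shifted∈S c = integral-multiple⇒InSbInv (shifted c) (a ℤ.* p ℤ.- c ℤ.* + q) q⊥b (shifted-*-q c)

  q*[Tp-bc]≡b*[ap-cq]-p : ∀ c → + q ℤ.* (T ℤ.* p ℤ.- + b ℤ.* c) ≡ + b ℤ.* (a ℤ.* p ℤ.- c ℤ.* + q) ℤ.- p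
  q*[Tp-bc]≡b*[ap-cq]-p c = begin
    + q ℤ.* (T ℤ.* p ℤ.- + b ℤ.* c)
      ≡⟨ solve 5 (λ Q T p B c → Q :* (T :* p :- B :* c) := (T :* Q) :* p :- B :* (c :* Q)) refl (+ q) T p (+ b) c ⟩
    (T ℤ.* + q) ℤ.* p ℤ.- + b ℤ.* (c ℤ.* + q)
      ≡⟨ cong (λ u → u ℤ.* p ℤ.- + b ℤ.* (c ℤ.* + q)) ab-1≡Tq ⟨
    (a ℤ.* + b ℤ.- + 1) ℤ.* p ℤ.- + b ℤ.* (c ℤ.* + q)
      ≡⟨ solve 5 (λ A B p c Q → (A :* B :- con (+ 1)) :* p :- B :* (c :* Q) := B :* (A :* p :- c :* Q) :- p) refl a (+ b) p c (+ q) ⟩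
    + b ℤ.* (a ℤ.* p ℤ.- c ℤ.* + q) ℤ.- p ∎
    where
      open ≡-Reasoning
      open ℤSolver

  aα∈ℤ⇒α∈ℤ : IsInt (ι a * α) → IsInt α
  aα∈ℤ⇒α∈ℤ aα∈ℤ = subst IsInt (sym α≡integer) (d-ι (+ b ℤ.* ↥ (ι a * α) ℤ.- T ℤ.* p))
    where
    open ≡-Reasoning
    α≡integer : α ≡ ι (+ b ℤ.* ↥ (ι a * α) ℤ.- T ℤ.* p)
    α≡integer = begin
      α
        ≡⟨ solve 3 (λ T Q α → α := (con 1ℚ :+ T :* Q) :* α :- T :* (α :* Q)) refl (ι T) (ι (+ q)) α ⟩
      (1ℚ + ι T * ι (+ q)) * α - ι T * (α * ι (+ q))
        ≡⟨ cong₂ (λ u v → u * α - ι T * v) (sym ιa*ιb≡1+ιT*ιq) (*-d≡↥ α) ⟩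
      (ι a * ι (+ b)) * α - ι T * ι p
        ≡⟨ solve 4 (λ A B α Tp → (A :* B) :* α :- Tp := B :* (A :* α) :- Tp) refl (ι a) (ι (+ b)) α (ι T * ι p) ⟩
      ι (+ b) * (ι a * α) - ι T * ι p
        ≡⟨ cong (λ u → ι (+ b) * u - ι T * ι p) (IsInt⇒≡ι↥ (ι a * α) aα∈ℤ) ⟩
      ι (+ b) * ι (↥ (ι a * α)) - ι T * ι p
        ≡⟨ cong₂ _-_ (ι-homo-* (+ b) (↥ (ι a * α))) (ι-homo-* T p) ⟨
      ι (+ b ℤ.* ↥ (ι a * α)) - ι (T ℤ.* p)
        ≡⟨ ι-homo-- (+ b ℤ.* ↥ (ι a * α)) (T ℤ.* p) ⟨
      ι (+ b ℤ.* ↥ (ι a * α) ℤ.- T ℤ.* p) ∎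
      where
        open ℚSolver

  c₀ : ℤ
  c₀ = proj₁ (⟨⟩-shift (ι a * α))

  ⟨aα⟩≡shifted : ⟨ ι a * α ⟩ ≡ shifted c₀
  ⟨aα⟩≡shifted = proj₂ (⟨⟩-shift (ι a * α))

  D-IsDb : IsDb b α (⟨ ι a * α ⟩ - ι (floor (⟨ ι a * α ⟩ - α * (+ 1 / b))))
  D-IsDb = IsDb-intro K (subst (InSbInv b) (sym D≡shifted) (shifted∈S (c₀ ℤ.+ m))) bD-α≡K
                      (ι-scale-mono-≤ b {i = + 0} (0*ι≡ι0 b) [x-m]*b≡K (0≤x-ι⌊x⌋ x))
                      (ι-scale-mono-< b [x-m]*b≡K (1*ι≡ι b) (x-ι⌊x⌋<1 x))
    where
    open ≡-Reasoning
    x : ℚ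
    x = ⟨ ι a * α ⟩ - α * (+ 1 / b)
    m : ℤ
    m = floor x
    D : ℚ
    D = ⟨ ι a * α ⟩ - ι m
    K : ℤ
    K = T ℤ.* p ℤ.- + b ℤ.* (c₀ ℤ.+ m)
    D≡shifted : D ≡ shifted (c₀ ℤ.+ m)
    D≡shifted = begin
      ⟨ ι a * α ⟩ - ι m            ≡⟨ cong (_- ι m) ⟨aα⟩≡shifted ⟩
      (ι a * α - ι c₀) - ι m       ≡⟨ solve 3 (λ y c m → (y :- c) :- m := y :- (c :+ m)) refl (ι a * α) (ι c₀) (ι m) ⟩
      ι a * α - (ι c₀ + ι m)       ≡⟨ cong (λ u → ι a * α - u) (ι-homo-+ c₀ m) ⟨
      ι a * α - ι (c₀ ℤ.+ m)       ∎
      where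
        open ℚSolver
    bD-α≡K : ι (+ b) * D - α ≡ ι K
    bD-α≡K = trans (cong (λ u → ι (+ b) * u - α) D≡shifted) (b*shifted-α (c₀ ℤ.+ m))
    [x-m]*b≡K : (x - ι m) * ι (+ b) ≡ ι K
    [x-m]*b≡K = begin
      (⟨ ι a * α ⟩ - α * (+ 1 / b) - ι m) * ι (+ b)
        ≡⟨ solve 4 (λ F A M B → (F :- A :- M) :* B := B :* (F :- M) :- A :* B) refl ⟨ ι a * α ⟩ (α * (+ 1 / b)) (ι m) (ι (+ b)) ⟩
      ι (+ b) * D - α * (+ 1 / b) * ι (+ b)
        ≡⟨ cong (λ u → ι (+ b) * D - u) (*1/n*n≡id α b) ⟩
      ι (+ b) * D - α
        ≡⟨ bD-α≡K ⟩
      ι K ∎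
      where
        open ℚSolver

  ⟨aα⟩-IsDb : 𝔫 α ℕ.≤ b → ¬ (IsInt α × α ≤ 0ℚ) → IsDb b α ⟨ ι a * α ⟩
  ⟨aα⟩-IsDb 𝔫≤b α∉ℤ≤0 = IsDb-intro K (subst (InSbInv b) (sym ⟨aα⟩≡shifted) (shifted∈S c₀)) bF-α≡K
                                   (proj₁ 0≤K×K<b) (proj₂ 0≤K×K<b)
    where
    z : ℤ
    z = a ℤ.* p ℤ.- c₀ ℤ.* + q
    K : ℤ
    K = T ℤ.* p ℤ.- + b ℤ.* c₀
    Fq≡z : ⟨ ι a * α ⟩ * ι (+ q) ≡ ι z
    Fq≡z = trans (cong (_* ι (+ q)) ⟨aα⟩≡shifted) (shifted-*-q c₀)
    bF-α≡K : ι (+ b) * ⟨ ι a * α ⟩ - α ≡ ι K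
    bF-α≡K = trans (cong (λ u → ι (+ b) * u - α) ⟨aα⟩≡shifted) (b*shifted-α c₀)
    1≤z : + 1 ℤ.≤ z
    1≤z = ℤP.i<j⇒suc[i]≤j (ι-scale-mono-< q {i = + 0} (0*ι≡ι0 q) Fq≡z (0<⟨⟩ (ι a * α)))
    z≤q : z ℤ.≤ + q
    z≤q = ι-scale-mono-≤ q Fq≡z (1*ι≡ι q) (⟨⟩≤1 (ι a * α))
    0<p⊎z<q : + 0 ℤ.< p ⊎ z ℤ.< + q
    -- z = q only if aα ∈ ℤ, hence α ∈ ℤ; such an α is positive by hypothesis.
    0<p⊎z<q with d α ℕ.≟ 1
    ... | yes α∈ℤ = inj₁ (ι-cancel-< {+ 0} (subst (0ℚ <_) (IsInt⇒≡ι↥ α α∈ℤ) (ℚP.≰⇒> (α∉ℤ≤0 ∘ (α∈ℤ ,_)))))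
    ... | no α∉ℤ = inj₂ (ι-scale-mono-< q Fq≡z (1*ι≡ι q) (⟨⟩<1 (ι a * α) (α∉ℤ ∘ aα∈ℤ⇒α∈ℤ)))
    0≤K×K<b : + 0 ℤ.≤ K × K ℤ.< + b
    0≤K×K<b = q*K≡b*z-p⇒0≤K<b (q*[Tp-bc]≡b*[ap-cq]-p c₀) 1≤z z≤q
                (proj₁ (𝔫≤b⇒bounds α 𝔫≤b)) (proj₂ (𝔫≤b⇒bounds α 𝔫≤b)) 0<p⊎z<q

proposition3p3 : (b : ℕ) → .{{_ : ℕ.NonZero b}} → (α : ℚ) → InSbInv b α →
    (a : ℤ) → (+ d α) ∣ℤ (a ℤ.* + b ℤ.- + 1) →
    let D = ⟨ ι a * α ⟩ - ι (floor (⟨ ι a * α ⟩ - α * (+ 1 / b))) in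
    (IsDb b α D × ((β : ℚ) → IsDb b α β → β ≡ D))
    × (b ℕ.≥ 𝔫 α →
        ((¬ (IsInt α × α ≤ 0ℚ)) → D ≡ ⟨ ι a * α ⟩)
        × ((IsInt α × α ≤ 0ℚ) → D ≡ 0ℚ))
proposition3p3 b α α∈S a q∣ab-1 =
  (D-IsDb , λ β β-IsDb → IsDb-unique β-IsDb D-IsDb) ,
  λ 𝔫≤b → (λ α∉ℤ≤0 → IsDb-unique D-IsDb (⟨aα⟩-IsDb 𝔫≤b α∉ℤ≤0)) ,
          (λ (α∈ℤ , α≤0) → IsDb-unique D-IsDb (IsDb-0 𝔫≤b α∈ℤ α≤0))
  where
  open Signed._∣_ (Signed.∣ᵤ⇒∣ {+ d α} {a ℤ.* + b ℤ.- + 1} q∣ab-1)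
  open ModularInverse b α (Coprimality.gcd≡1⇒coprime α∈S) a quotient equality
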